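{- $1\mathrm{C}_{=}$ is closed under intersection and $\mathrm{co}\text{ - }1\mathrm{C}_{=}$ is closed under union.
   Context: A one-way nondeterministic finite automaton (1nfa) is $M=(Q,\Sigma,\{\rhd,\lhd\},\delta,q_0,Q_{acc},Q_{rej})$: finite state set $Q$, input alphabet $\Sigma$, endmarkers $\rhd,\lhd\notin\Sigma$, disjoint sets $Q_{acc},Q_{rej}\subseteq Q$ ($Q_{halt}=Q_{acc}\cup Q_{rej}$), transition function $\delta:(Q-Q_{halt})\times(\Sigma\cup\{\rhd,\lhd\})\to\mathcal P(Q)$. On input $x$ it reads $\rhd x\lhd$ left to right, moving its head one cell right at every step (no $\lambda$-moves), halting on entering a halting state. A path is accepting (resp. rejecting) if it enters $Q_{acc}$ (resp. $Q_{rej}$), otherwise neither. $\#M(x)$, $\#\overline{M}(x)$ are the numbers of accepting and rejecting paths on $x$. A family $\{M_n\}_{n\in\mathbb N}$ has polynomial size if $|Q_n|\le p(n)$ for a fixed polynomial $p$. A family of promise problems over a fixed alphabet $\Sigma$ is $\mathcal L=\{(L_n^{(+)},L_n^{(-)})\}_{n\in\mathbb N}$ with $L_n^{(+)},L_n^{(-)}\subseteq\Sigma^*$ disjoint; $\mathrm{co}\text{ - }\mathcal L=\{(L_n^{(-)},L_n^{(+)})\}_n$ and $\mathrm{co}\text{ - }\mathcal C=\{\mathrm{co}\text{ - }\mathcal L:\mathcal L\in\mathcal C\}$. For $\mathcal L$ and $\mathcal K=\{(K_n^{(+)},K_n^{(-)})\}_n$: $\mathcal L\cap\mathcal K=\{(L_n^{(+)}\cap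 K_n^{(+)},L_n^{(-)}\cup K_n^{(-)})\}_n$ and $\mathcal L\cup\mathcal K=\{(L_n^{(+)}\cup K_n^{(+)},L_n^{(-)}\cap K_n^{(-)})\}_n$; a class is closed under intersection (union) if it contains $\mathcal L\cap\mathcal K$ ($\mathcal L\cup\mathcal K$) whenever it contains $\mathcal L,\mathcal K$. A family of partial functions is $\{(f_n,D_n)\}_n$, $D_n\subseteq\Sigma^*$. $1\mathrm{Gap}$ is the class of such families for which a polynomial-size family of 1nfa's satisfies $f_n(x)=\#M_n(x)-\#\overline{M}_n(x)$ for all $n$, $x\in D_n$. $\mathcal L\in1\mathrm C_{=}$ iff some $\{(f_n,D_n)\}\in1\mathrm{Gap}$ has $L_n^{(+)}\cup L_n^{(-)}\subseteq D_n$, $f_n=0$ on $L_n^{(+)}$ and $f_n\ne0$ on $L_n^{(-)}$ for all $n$. -}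

module Defs where

open import Data.Nat using (ℕ; zero; suc; _+_; _*_; _^_; _≤_)
open import Data.Integer using (ℤ; +_; _-_)
open import Data.Fin using (Fin)
open import Data.Bool using (Bool; true; false; if_then_else_)
open import Data.List using (List; []; _∷_; map; _++_; [_])
open import Data.Product using (Σ; _×_; _,_; ∃; ∃-syntax; proj₁; proj₂)
open import Data.Sum using (_⊎_; inj₁; inj₂)
open import Data.Empty using (⊥)
open import Relation.Nullary using (¬_)
open import Relation.Binary.PropositionalEquality using (_≡_)

-- Tape symbols: input letters from the fixed alphabet Σ = Fin k, plus
-- the two endmarkers ▹ (left, ⊳) and ◃ (right, ⊲).

data Sym (k : ℕ) : Set where
  sym : Fin k → Sym k
  ▹   : Sym k
  ◃   : Sym k

tape : {k : ℕ} → List (Fin k) → List (Sym k)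
tape x = ▹ ∷ (map sym x ++ [ ◃ ])

-- Classification of states: accepting, rejecting, or non-halting.
-- (This encodes disjoint Q_acc, Q_rej ⊆ Q.)
data Kind : Set where
  acc rej non : Kind

-- A one-way nfa with states Fin states.  δ q a q' = true means q' ∈ δ(q,a);
-- δ is only ever consulted on non-halting states.
record NFA (k : ℕ) : Set where
  field
    states : ℕ
    start  : Fin states
    kind   : Fin states → Kind
    δ      : Fin states → Sym k → Fin states → Bool

sumFin : (n : ℕ) → (Fin n → ℕ) → ℕ
sumFin zero    f = 0
sumFin (suc n) f = f Fin.zero + sumFin n (λ i → f (Fin.suc i))

-- Halting happens on entering a halting state; a
-- non-halting path that runs off the tape or is blocked counts for neither.
module _ {k : ℕ} (M : NFA k) where
  open NFA M

  accPaths : Fin states → List (Sym k) → ℕ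
  accPaths q w with kind q
  ... | acc = 1
  ... | rej = 0
  accPaths q [] | non = 0
  accPaths q (a ∷ w) | non =
    sumFin states (λ q' → if δ q a q' then accPaths q' w else 0)

  rejPaths : Fin states → List (Sym k) → ℕ
  rejPaths q w with kind q
  ... | acc = 0
  ... | rej = 1
  rejPaths q [] | non = 0
  rejPaths q (a ∷ w) | non =
    sumFin states (λ q' → if δ q a q' then rejPaths q' w else 0)

#acc : {k : ℕ} → NFA k → List (Fin k) → ℕ
#acc M x = accPaths M (NFA.start M) (tape x)

#rej : {k : ℕ} → NFA k → List (Fin k) → ℕ
#rej M x = rejPaths M (NFA.start M) (tape x)

gap : {k : ℕ} → NFA k → List (Fin k) → ℤ
gap M x = + #acc M x - + #rej M x

PolySize : {k : ℕ} → (ℕ → NFA k) → Set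
PolySize M = ∃[ c ] ∃[ d ] (∀ n → NFA.states (M n) ≤ c * n ^ d + c)

record PromiseFamily (k : ℕ) : Set₁ where
  field
    Pos : ℕ → List (Fin k) → Set
    Neg : ℕ → List (Fin k) → Set
    disjoint : ∀ n x → Pos n x → Neg n x → ⊥
open PromiseFamily public

co : {k : ℕ} → PromiseFamily k → PromiseFamily k
co L = record { Pos = Neg L ; Neg = Pos L
              ; disjoint = λ n x p q → disjoint L n x q p }

_∩ᶠ_ : {k : ℕ} → PromiseFamily k → PromiseFamily k → PromiseFamily k
L ∩ᶠ K = record
  { Pos = λ n x → Pos L n x × Pos K n x
  ; Neg = λ n x → Neg L n x ⊎ Neg K n x
  ; disjoint = λ { n x (p , _) (inj₁ q) → disjoint L n x p q
                 ; n x (_ , p) (inj₂ q) → disjoint K n x p q } }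

_∪ᶠ_ : {k : ℕ} → PromiseFamily k → PromiseFamily k → PromiseFamily k
L ∪ᶠ K = record
  { Pos = λ n x → Pos L n x ⊎ Pos K n x
  ; Neg = λ n x → Neg L n x × Neg K n x
  ; disjoint = λ { n x (inj₁ p) (q , _) → disjoint L n x p q
                 ; n x (inj₂ p) (_ , q) → disjoint K n x p q } }

Class : ℕ → Set₂
Class k = PromiseFamily k → Set₁

coClass : {k : ℕ} → Class k → Class k
coClass C L = Σ (PromiseFamily _) (λ K → C K × co K ≡ L)

ClosedUnderIntersection : {k : ℕ} → Class k → Set₁
ClosedUnderIntersection C = ∀ L K → C L → C K → C (L ∩ᶠ K)

ClosedUnderUnion : {k : ℕ} → Class k → Set₁
ClosedUnderUnion C = ∀ L K → C L → C K → C (L ∪ᶠ K)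

record PartialFamily (k : ℕ) : Set₁ where
  field
    f : ℕ → List (Fin k) → ℤ
    D : ℕ → List (Fin k) → Set
open PartialFamily public

1Gap : {k : ℕ} → PartialFamily k → Set
1Gap {k} F = Σ (ℕ → NFA k) λ M →
  PolySize M × (∀ n x → D F n x → f F n x ≡ gap (M n) x)

1C= : {k : ℕ} → Class k
1C= {k} L = Σ (PartialFamily k) λ F →
  1Gap F
  × (∀ n x → Pos L n x ⊎ Neg L n x → D F n x)
  × (∀ n x → Pos L n x → f F n x ≡ + 0)
  × (∀ n x → Neg L n x → ¬ (f F n x ≡ + 0))

-- If polynomial-size 1nfa families with gaps f and g witness L and K in 1C=, then f² + g²
-- vanishes exactly where both do, so it witnesses L ∩ K, and it is again such a gap.
-- Running two machines in lockstep, each idling once it has halted and the pair accepting iff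
-- their verdicts agree, multiplies gaps (M ⊗ N); a fresh initial state that branches on ⊳ into
-- either machine adds them (M ⊕ N); both constructions stay polynomial in size. Closure of
-- co-1C= under union is the same fact, as co L ∪ co K = co (L ∩ K).

module Submission where

open import Defs hiding (sym)
open import Data.Bool using (Bool; true; false; _∧_; if_then_else_)
open import Data.Fin using (Fin; zero; suc; _↑ˡ_; _↑ʳ_; combine; remQuot; splitAt; join; _≟_)
open import Data.Fin.Properties using (remQuot-combine; splitAt-join)
open import Data.List using (List; []; _∷_; map; _++_; [_])
import Data.Nat as ℕ
import Data.Nat.Properties as ℕ
open import Data.Product using (_×_; _,_; ∃-syntax)
open import Data.Sum using (_⊎_; inj₁; inj₂; [_,_]′)
open import Data.Unit using (⊤; tt)
open import Function using (_∘_; id)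
open import Relation.Nullary using (¬_)
open import Relation.Nullary.Decidable using (does)
open import Relation.Binary.PropositionalEquality
  using (_≡_; refl; sym; trans; subst; cong; cong₂; module ≡-Reasoning)

module _ where
  open import Data.Nat using (ℕ; zero; suc; _+_; _*_; _^_; _≤_; z≤n; s≤s)
  open import Data.Nat.Properties
  open import Data.Nat.Tactic.RingSolver using (solve-∀)

  PolyBounded : (ℕ → ℕ) → Set
  PolyBounded s = ∃[ c ] ∃[ d ] (∀ n → s n ≤ c * n ^ d + c)

  n^d≤n^[d+e]+1 : ∀ n d e → n ^ d ≤ n ^ (d + e) + 1
  n^d≤n^[d+e]+1 zero    zero    e = m≤n+m 1 _
  n^d≤n^[d+e]+1 zero    (suc d) e = z≤n
  n^d≤n^[d+e]+1 (suc n) d       e = m≤n⇒m≤n+o 1 (^-monoʳ-≤ (suc n) (m≤m+n d e))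

  n^e≤n^[d+e]+1 : ∀ n d e → n ^ e ≤ n ^ (d + e) + 1
  n^e≤n^[d+e]+1 n d e = subst (λ d+e → n ^ e ≤ n ^ d+e + 1) (+-comm e d) (n^d≤n^[d+e]+1 n e d)

  bound-weaken : ∀ c {X N} → X ≤ N + 1 → c * X + c ≤ 2 * c * N + 2 * c
  bound-weaken c {X} {N} X≤N+1 = begin
    c * X + c           ≤⟨ +-monoˡ-≤ c (*-monoʳ-≤ c X≤N+1) ⟩
    c * (N + 1) + c     ≡⟨ regroup c N ⟩
    c * N + 2 * c       ≤⟨ +-monoˡ-≤ (2 * c) (*-monoˡ-≤ N (m≤n*m c 2)) ⟩
    2 * c * N + 2 * c   ∎
    where
    open ≤-Reasoning
    regroup : ∀ c N → c * (N + 1) + c ≡ c * N + 2 * c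
    regroup = solve-∀

  polyBounded-+ : ∀ {f g} → PolyBounded f → PolyBounded g → PolyBounded (λ n → f n + g n)
  polyBounded-+ {f} {g} (c₁ , d₁ , f≤) (c₂ , d₂ , g≤) =
    2 * c₁ + 2 * c₂ , d₁ + d₂ , λ n → begin
    f n + g n
      ≤⟨ +-mono-≤ (f≤ n) (g≤ n) ⟩
    (c₁ * n ^ d₁ + c₁) + (c₂ * n ^ d₂ + c₂)
      ≤⟨ +-mono-≤ (bound-weaken c₁ (n^d≤n^[d+e]+1 n d₁ d₂))
                  (bound-weaken c₂ (n^e≤n^[d+e]+1 n d₁ d₂)) ⟩
    (2 * c₁ * n ^ (d₁ + d₂) + 2 * c₁) + (2 * c₂ * n ^ (d₁ + d₂) + 2 * c₂)
      ≡⟨ collect c₁ c₂ (n ^ (d₁ + d₂)) ⟩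
    (2 * c₁ + 2 * c₂) * n ^ (d₁ + d₂) + (2 * c₁ + 2 * c₂) ∎
    where
    open ≤-Reasoning
    collect : ∀ a b N → (2 * a * N + 2 * a) + (2 * b * N + 2 * b)
                      ≡ (2 * a + 2 * b) * N + (2 * a + 2 * b)
    collect = solve-∀

  polyBounded-* : ∀ {f g} → PolyBounded f → PolyBounded g → PolyBounded (λ n → f n * g n)
  polyBounded-* {f} {g} (c₁ , d₁ , f≤) (c₂ , d₂ , g≤) = 3 * (c₁ * c₂) , d₁ + d₂ , λ n →
    let X = n ^ d₁; Y = n ^ d₂; N = n ^ (d₁ + d₂)
        XY≤N = ≤-reflexive (sym (^-distribˡ-+-* n d₁ d₂))
    in begin
    f n * g n                                 ≤⟨ *-mono-≤ (f≤ n) (g≤ n) ⟩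
    (c₁ * X + c₁) * (c₂ * Y + c₂)             ≡⟨ expand c₁ c₂ X Y ⟩
    c₁ * c₂ * (X * Y + X + Y + 1)
      ≤⟨ *-monoʳ-≤ (c₁ * c₂) (+-monoˡ-≤ 1 (+-mono-≤ (+-mono-≤ XY≤N (n^d≤n^[d+e]+1 n d₁ d₂))
                                                   (n^e≤n^[d+e]+1 n d₁ d₂))) ⟩
    c₁ * c₂ * (N + (N + 1) + (N + 1) + 1)     ≡⟨ collect (c₁ * c₂) N ⟩
    3 * (c₁ * c₂) * N + 3 * (c₁ * c₂)         ∎
    where
    open ≤-Reasoning
    expand : ∀ a b X Y → (a * X + a) * (b * Y + b) ≡ a * b * (X * Y + X + Y + 1)
    expand = solve-∀
    collect : ∀ a N → a * (N + (N + 1) + (N + 1) + 1) ≡ 3 * a * N + 3 * a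
    collect = solve-∀

  polyBounded-suc : ∀ {f} → PolyBounded f → PolyBounded (λ n → suc (f n))
  polyBounded-suc {f} (c , d , f≤) = suc c , d , λ n → begin
    suc (f n)                      ≤⟨ s≤s (f≤ n) ⟩
    suc (c * n ^ d + c)            ≤⟨ m≤n+m _ (n ^ d) ⟩
    n ^ d + suc (c * n ^ d + c)    ≡⟨ collect c (n ^ d) ⟩
    suc c * n ^ d + suc c          ∎
    where
    open ≤-Reasoning
    collect : ∀ c X → X + suc (c * X + c) ≡ suc c * X + suc c
    collect = solve-∀

open import Data.Integer using (ℤ; +_; 0ℤ; 1ℤ; -1ℤ; -[1+_]; _+_; _-_; _*_; ∣_∣)
open import Data.Integer.Properties
  using ( +-*-semiring; +-identityˡ; +-identityʳ; +-assoc; *-identityˡ; pos-+; pos-*; +-injective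
        ; i*j≡0⇒i≡0∨j≡0)
open import Data.Integer.Tactic.RingSolver using (solve-∀)
open import Algebra.Properties.Semiring.Sum +-*-semiring
  using (sum; sum-syntax; sum-cong-≗; *-distribˡ-sum; *-distribʳ-sum; sum-replicate-zero)

⟦_⟧ : Bool → ℤ
⟦ true ⟧  = 1ℤ
⟦ false ⟧ = 0ℤ

⟦∧⟧-* : ∀ b c x y → ⟦ b ∧ c ⟧ * (x * y) ≡ (⟦ b ⟧ * x) * (⟦ c ⟧ * y)
⟦∧⟧-* true  c x y = rearrange ⟦ c ⟧ x y
  where
  rearrange : ∀ z x y → z * (x * y) ≡ (1ℤ * x) * (z * y)
  rearrange = solve-∀
⟦∧⟧-* false c x y = refl

+if-+if : ∀ b x y → + (if b then x else 0) - + (if b then y else 0) ≡ ⟦ b ⟧ * (+ x - + y)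
+if-+if true  x y = sym (*-identityˡ (+ x - + y))
+if-+if false x y = refl

+sumFin-+sumFin : ∀ n (f g : Fin n → ℕ.ℕ) →
                  + sumFin n f - + sumFin n g ≡ ∑[ i < n ] (+ f i - + g i)
+sumFin-+sumFin ℕ.zero    f g = refl
+sumFin-+sumFin (ℕ.suc n) f g = begin
  + (f zero ℕ.+ sumFin n (f ∘ suc)) - + (g zero ℕ.+ sumFin n (g ∘ suc))
    ≡⟨ cong₂ _-_ (pos-+ (f zero) (sumFin n (f ∘ suc))) (pos-+ (g zero) (sumFin n (g ∘ suc))) ⟩
  (+ f zero + + sumFin n (f ∘ suc)) - (+ g zero + + sumFin n (g ∘ suc))
    ≡⟨ interchange (+ f zero) (+ sumFin n (f ∘ suc)) (+ g zero) (+ sumFin n (g ∘ suc)) ⟩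
  (+ f zero - + g zero) + (+ sumFin n (f ∘ suc) - + sumFin n (g ∘ suc))
    ≡⟨ cong (_+_ (+ f zero - + g zero)) (+sumFin-+sumFin n (f ∘ suc) (g ∘ suc)) ⟩
  (+ f zero - + g zero) + ∑[ i < n ] (+ f (suc i) - + g (suc i)) ∎
  where
  open ≡-Reasoning
  interchange : ∀ a s b t → (a + s) - (b + t) ≡ (a - b) + (s - t)
  interchange = solve-∀

∑-split : ∀ m {n} (f : Fin (m ℕ.+ n) → ℤ) →
          ∑[ c < m ℕ.+ n ] f c ≡ ∑[ i < m ] f (i ↑ˡ n) + ∑[ j < n ] f (m ↑ʳ j)
∑-split ℕ.zero    f = sym (+-identityˡ _)
∑-split (ℕ.suc m) f = trans (cong (_+_ (f zero)) (∑-split m (f ∘ suc))) (sym (+-assoc (f zero) _ _))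

∑-combine : ∀ m {n} (f : Fin (m ℕ.* n) → ℤ) →
            ∑[ c < m ℕ.* n ] f c ≡ ∑[ i < m ] ∑[ j < n ] f (combine i j)
∑-combine ℕ.zero    f = refl
∑-combine (ℕ.suc m) {n} f =
  trans (∑-split n f) (cong (_+_ (sum (f ∘ (_↑ˡ m ℕ.* n)))) (∑-combine m (f ∘ (n ↑ʳ_))))

∑-*-∑ : ∀ {m n} (f : Fin m → ℤ) (g : Fin n → ℤ) →
        sum f * sum g ≡ ∑[ i < m ] ∑[ j < n ] (f i * g j)
∑-*-∑ f g = trans (*-distribʳ-sum (sum g) f) (sum-cong-≗ λ i → *-distribˡ-sum (f i) g)

∑-⟦≟⟧ : ∀ {n} (p : Fin n) (g : Fin n → ℤ) →
        ∑[ i < n ] (⟦ does (p ≟ i) ⟧ * g i) ≡ g p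
∑-⟦≟⟧ {ℕ.suc n} zero    g =
  trans (cong₂ _+_ (*-identityˡ (g zero)) (sum-replicate-zero n)) (+-identityʳ (g zero))
∑-⟦≟⟧ {ℕ.suc n} (suc p) g =
  trans (+-identityˡ (∑[ i < n ] (⟦ does (suc p ≟ suc i) ⟧ * g (suc i))))
        (∑-⟦≟⟧ p (g ∘ suc))

i*i≡+∣i∣*∣i∣ : ∀ i → i * i ≡ + (∣ i ∣ ℕ.* ∣ i ∣)
i*i≡+∣i∣*∣i∣ (+ n)    = sym (pos-* n n)
i*i≡+∣i∣*∣i∣ -[1+ n ] = refl

i*i≡0⇒i≡0 : ∀ i → i * i ≡ 0ℤ → i ≡ 0ℤ
i*i≡0⇒i≡0 i eq = [ id , id ]′ (i*j≡0⇒i≡0∨j≡0 i eq)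

i*i+j*j≡0⇒i≡0×j≡0 : ∀ i j → i * i + j * j ≡ 0ℤ → i ≡ 0ℤ × j ≡ 0ℤ
i*i+j*j≡0⇒i≡0×j≡0 i j eq =
  square-zero i (ℕ.m+n≡0⇒m≡0 _ sum≡0) , square-zero j (ℕ.m+n≡0⇒n≡0 _ sum≡0)
  where
  sum≡0 : ∣ i ∣ ℕ.* ∣ i ∣ ℕ.+ ∣ j ∣ ℕ.* ∣ j ∣ ≡ 0
  sum≡0 = +-injective (begin
    + (∣ i ∣ ℕ.* ∣ i ∣ ℕ.+ ∣ j ∣ ℕ.* ∣ j ∣)
      ≡⟨ pos-+ (∣ i ∣ ℕ.* ∣ i ∣) _ ⟩
    + (∣ i ∣ ℕ.* ∣ i ∣) + + (∣ j ∣ ℕ.* ∣ j ∣)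
      ≡⟨ sym (cong₂ _+_ (i*i≡+∣i∣*∣i∣ i) (i*i≡+∣i∣*∣i∣ j)) ⟩
    i * i + j * j
      ≡⟨ eq ⟩
    0ℤ ∎)
    where open ≡-Reasoning
  square-zero : ∀ i → ∣ i ∣ ℕ.* ∣ i ∣ ≡ 0 → i ≡ 0ℤ
  square-zero i eq = i*i≡0⇒i≡0 i (trans (i*i≡+∣i∣*∣i∣ i) (cong +_ eq))

settle : Kind → ℤ → ℤ
settle acc _ = 1ℤ
settle rej _ = -1ℤ
settle non r = r

settle-idem : ∀ x r → settle x (settle x r) ≡ settle x r
settle-idem acc r = refl
settle-idem rej r = refl
settle-idem non r = refl

halting : Kind → Bool
halting non = false
halting _   = true

module _ {k} (M : NFA k) where
  open NFA M

  gapFrom : Fin states → List (Sym k) → ℤ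
  gapFrom q []      = settle (kind q) 0ℤ
  gapFrom q (a ∷ w) = settle (kind q) (∑[ q' < states ] (⟦ δ q a q' ⟧ * gapFrom q' w))

  accPaths-rejPaths≡gapFrom : ∀ q w → + accPaths M q w - + rejPaths M q w ≡ gapFrom q w
  accPaths-rejPaths≡gapFrom q [] with kind q
  ... | acc = refl
  ... | rej = refl
  ... | non = refl
  accPaths-rejPaths≡gapFrom q (a ∷ w) with kind q
  ... | acc = refl
  ... | rej = refl
  ... | non = trans (+sumFin-+sumFin states _ _) (sum-cong-≗ λ q' →
    trans (+if-+if (δ q a q') _ _) (cong (⟦ δ q a q' ⟧ *_) (accPaths-rejPaths≡gapFrom q' w)))

  gap≡gapFrom : ∀ x → gap M x ≡ gapFrom start (tape x)
  gap≡gapFrom x = accPaths-rejPaths≡gapFrom start (tape x)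

  gapFrom-settled : ∀ {q x} w → kind q ≡ x → gapFrom q w ≡ settle x (gapFrom q w)
  gapFrom-settled {q} []      refl = sym (settle-idem (kind q) _)
  gapFrom-settled {q} (a ∷ w) refl = sym (settle-idem (kind q) _)

  δ↺ : Fin states → Sym k → Fin states → Bool
  δ↺ q a q' = if halting (kind q) then does (q ≟ q') else δ q a q'

  ∑-δ↺ : ∀ q a w → ∑[ q' < states ] (⟦ δ↺ q a q' ⟧ * gapFrom q' w) ≡ gapFrom q (a ∷ w)
  ∑-δ↺ q a w with kind q in eq
  ... | acc = trans (∑-⟦≟⟧ q (λ q' → gapFrom q' w)) (gapFrom-settled w eq)
  ... | rej = trans (∑-⟦≟⟧ q (λ q' → gapFrom q' w)) (gapFrom-settled w eq)
  ... | non = refl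

kind⊗ : Kind → Kind → Kind
kind⊗ acc acc = acc
kind⊗ rej rej = acc
kind⊗ acc rej = rej
kind⊗ rej acc = rej
kind⊗ _   _   = non

settle-kind⊗ : ∀ x y {r s t} → (kind⊗ x y ≡ non → t ≡ settle x r * settle y s) →
               settle (kind⊗ x y) t ≡ settle x r * settle y s
settle-kind⊗ acc acc _ = refl
settle-kind⊗ acc rej _ = refl
settle-kind⊗ rej acc _ = refl
settle-kind⊗ rej rej _ = refl
settle-kind⊗ acc non h = h refl
settle-kind⊗ rej non h = h refl
settle-kind⊗ non y   h = h refl

settle-0-kind⊗ : ∀ x y → kind⊗ x y ≡ non → 0ℤ ≡ settle x 0ℤ * settle y 0ℤ
settle-0-kind⊗ acc non _ = refl
settle-0-kind⊗ rej non _ = refl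
settle-0-kind⊗ non y   _ = refl

module _ {k} (M N : NFA k) where
  private
    module M = NFA M
    module N = NFA N

  kind× : Fin M.states × Fin N.states → Kind
  kind× (p , q) = kind⊗ (M.kind p) (N.kind q)

  δ× : Fin M.states × Fin N.states → Sym k → Fin M.states × Fin N.states → Bool
  δ× (p , q) a (p' , q') = δ↺ M p a p' ∧ δ↺ N q a q'

  _⊗_ : NFA k
  _⊗_ = record
    { states = M.states ℕ.* N.states
    ; start  = combine M.start N.start
    ; kind   = kind× ∘ split
    ; δ      = λ c a c' → δ× (split c) a (split c')
    }
    where split = remQuot {M.states} N.states

  private
    module P = NFA _⊗_

  kind-combine : ∀ p q → P.kind (combine p q) ≡ kind⊗ (M.kind p) (N.kind q)
  kind-combine p q = cong kind× (remQuot-combine p q)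

  gapFrom-⊗ : ∀ p q w → gapFrom _⊗_ (combine p q) w ≡ gapFrom M p w * gapFrom N q w
  gapFrom-⊗ p q [] =
    trans (cong (λ x → settle x 0ℤ) (kind-combine p q))
          (settle-kind⊗ (M.kind p) (N.kind q) (settle-0-kind⊗ (M.kind p) (N.kind q)))
  gapFrom-⊗ p q (a ∷ w) =
    trans (cong (λ x → settle x (sum viaP)) (kind-combine p q))
          (settle-kind⊗ (M.kind p) (N.kind q) (λ _ → continue))
    where
    open ≡-Reasoning
    viaM : Fin M.states → ℤ
    viaM p' = ⟦ δ↺ M p a p' ⟧ * gapFrom M p' w
    viaN : Fin N.states → ℤ
    viaN q' = ⟦ δ↺ N q a q' ⟧ * gapFrom N q' w
    viaP : Fin P.states → ℤ
    viaP c = ⟦ P.δ (combine p q) a c ⟧ * gapFrom _⊗_ c w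
    viaP-combine : ∀ p' q' → viaP (combine p' q') ≡ viaM p' * viaN q'
    viaP-combine p' q' = begin
      viaP (combine p' q')
        ≡⟨ cong₂ (λ r r' → ⟦ δ× r a r' ⟧ * gapFrom _⊗_ (combine p' q') w)
                 (remQuot-combine p q) (remQuot-combine p' q') ⟩
      ⟦ δ↺ M p a p' ∧ δ↺ N q a q' ⟧ * gapFrom _⊗_ (combine p' q') w
        ≡⟨ cong (⟦ δ↺ M p a p' ∧ δ↺ N q a q' ⟧ *_) (gapFrom-⊗ p' q' w) ⟩
      ⟦ δ↺ M p a p' ∧ δ↺ N q a q' ⟧ * (gapFrom M p' w * gapFrom N q' w)
        ≡⟨ ⟦∧⟧-* (δ↺ M p a p') (δ↺ N q a q') _ _ ⟩
      viaM p' * viaN q' ∎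
    continue : sum viaP ≡ gapFrom M p (a ∷ w) * gapFrom N q (a ∷ w)
    continue = begin
      sum viaP                                          ≡⟨ ∑-combine M.states viaP ⟩
      ∑[ p' < M.states ] ∑[ q' < N.states ] viaP (combine p' q')
        ≡⟨ sum-cong-≗ (λ p' → sum-cong-≗ (viaP-combine p')) ⟩
      ∑[ p' < M.states ] ∑[ q' < N.states ] (viaM p' * viaN q') ≡⟨ sym (∑-*-∑ viaM viaN) ⟩
      sum viaM * sum viaN
        ≡⟨ cong₂ _*_ (∑-δ↺ M p a w) (∑-δ↺ N q a w) ⟩
      gapFrom M p (a ∷ w) * gapFrom N q (a ∷ w)         ∎

  gap-⊗ : ∀ x → gap _⊗_ x ≡ gap M x * gap N x
  gap-⊗ x = begin
    gap _⊗_ x                                       ≡⟨ gap≡gapFrom _⊗_ x ⟩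
    gapFrom _⊗_ (combine M.start N.start) (tape x)  ≡⟨ gapFrom-⊗ M.start N.start (tape x) ⟩
    gapFrom M M.start (tape x) * gapFrom N N.start (tape x)
      ≡⟨ sym (cong₂ _*_ (gap≡gapFrom M x) (gap≡gapFrom N x)) ⟩
    gap M x * gap N x ∎
    where open ≡-Reasoning

module _ {k} (M N : NFA k) where
  private
    module M = NFA M
    module N = NFA N
    m = M.states
    n = N.states

  δ⊎ : Fin m ⊎ Fin n → Sym k → Fin m ⊎ Fin n → Bool
  δ⊎ (inj₁ p) a (inj₁ p') = M.δ p a p'
  δ⊎ (inj₂ q) a (inj₂ q') = N.δ q a q'
  δ⊎ _        _ _         = false

  kind⊎ : Fin m ⊎ Fin n → Kind
  kind⊎ = [ M.kind , N.kind ]′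

  kind⊕ : Fin (ℕ.suc (m ℕ.+ n)) → Kind
  kind⊕ zero    = non
  kind⊕ (suc c) = kind⊎ (splitAt m c)

  δ⊕ : Fin (ℕ.suc (m ℕ.+ n)) → Sym k → Fin (ℕ.suc (m ℕ.+ n)) → Bool
  δ⊕ _       _ zero     = false
  -- δ↺, since either start state may already be halting.
  δ⊕ zero    a (suc c') = [ δ↺ M M.start a , δ↺ N N.start a ]′ (splitAt m c')
  δ⊕ (suc c) a (suc c') = δ⊎ (splitAt m c) a (splitAt m c')

  _⊕_ : NFA k
  _⊕_ = record { states = ℕ.suc (m ℕ.+ n) ; start = zero ; kind = kind⊕ ; δ = δ⊕ }

  gapFrom⊎ : Fin m ⊎ Fin n → List (Sym k) → ℤ
  gapFrom⊎ = [ gapFrom M , gapFrom N ]′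

  mutual
    gapFrom-⊕-join : ∀ s w → gapFrom _⊕_ (suc (join m n s)) w ≡ gapFrom⊎ s w
    gapFrom-⊕-join (inj₁ p) [] = cong (λ s → settle (kind⊎ s) 0ℤ) (splitAt-join m n (inj₁ p))
    gapFrom-⊕-join (inj₂ q) [] = cong (λ s → settle (kind⊎ s) 0ℤ) (splitAt-join m n (inj₂ q))
    gapFrom-⊕-join s (a ∷ w) = begin
      gapFrom _⊕_ (suc (join m n s)) (a ∷ w)
        ≡⟨ cong (settle (kind⊕ (suc (join m n s))))
                (+-identityˡ (continue (splitAt m (join m n s)))) ⟩
      settle (kind⊕ (suc (join m n s))) (continue (splitAt m (join m n s)))
        ≡⟨ cong (λ s → settle (kind⊎ s) (continue s)) (splitAt-join m n s) ⟩
      settle (kind⊎ s) (continue s)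
        ≡⟨ cong (settle (kind⊎ s)) (∑-⊕ (δ⊎ s a) w) ⟩
      settle (kind⊎ s) (sum (viaM s) + sum (viaN s))
        ≡⟨ settle-gapFrom⊎ s ⟩
      gapFrom⊎ s (a ∷ w) ∎
      where
      open ≡-Reasoning
      continue : Fin m ⊎ Fin n → ℤ
      continue s = ∑[ c < m ℕ.+ n ] (⟦ δ⊎ s a (splitAt m c) ⟧ * gapFrom _⊕_ (suc c) w)
      viaM : Fin m ⊎ Fin n → Fin m → ℤ
      viaM s p = ⟦ δ⊎ s a (inj₁ p) ⟧ * gapFrom M p w
      viaN : Fin m ⊎ Fin n → Fin n → ℤ
      viaN s q = ⟦ δ⊎ s a (inj₂ q) ⟧ * gapFrom N q w
      settle-gapFrom⊎ : ∀ s → settle (kind⊎ s) (sum (viaM s) + sum (viaN s)) ≡ gapFrom⊎ s (a ∷ w)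
      settle-gapFrom⊎ (inj₁ p) = cong (settle (M.kind p))
        (trans (cong (_+_ (sum (viaM (inj₁ p)))) (sum-replicate-zero n)) (+-identityʳ _))
      settle-gapFrom⊎ (inj₂ q) = cong (settle (N.kind q))
        (trans (cong (_+ sum (viaN (inj₂ q))) (sum-replicate-zero m)) (+-identityˡ _))

    ∑-⊕ : ∀ (t : Fin m ⊎ Fin n → Bool) w →
          ∑[ c < m ℕ.+ n ] (⟦ t (splitAt m c) ⟧ * gapFrom _⊕_ (suc c) w)
            ≡ ∑[ p < m ] (⟦ t (inj₁ p) ⟧ * gapFrom M p w)
              + ∑[ q < n ] (⟦ t (inj₂ q) ⟧ * gapFrom N q w)
    ∑-⊕ t w = trans (∑-split m _) (cong₂ _+_ (sum-cong-≗ (term ∘ inj₁)) (sum-cong-≗ (term ∘ inj₂)))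
      where
      term : ∀ s → ⟦ t (splitAt m (join m n s)) ⟧ * gapFrom _⊕_ (suc (join m n s)) w
                 ≡ ⟦ t s ⟧ * gapFrom⊎ s w
      term s = cong₂ (λ s′ g → ⟦ t s′ ⟧ * g) (splitAt-join m n s) (gapFrom-⊕-join s w)

  gapFrom-⊕-start : ∀ a w →
                    gapFrom _⊕_ zero (a ∷ w) ≡ gapFrom M M.start (a ∷ w) + gapFrom N N.start (a ∷ w)
  gapFrom-⊕-start a w = begin
    gapFrom _⊕_ zero (a ∷ w)                      ≡⟨ +-identityˡ (sum startStep) ⟩
    sum startStep                                 ≡⟨ ∑-⊕ [ δ↺ M M.start a , δ↺ N N.start a ]′ w ⟩
    ∑[ p < m ] (⟦ δ↺ M M.start a p ⟧ * gapFrom M p w)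
      + ∑[ q < n ] (⟦ δ↺ N N.start a q ⟧ * gapFrom N q w)
      ≡⟨ cong₂ _+_ (∑-δ↺ M M.start a w) (∑-δ↺ N N.start a w) ⟩
    gapFrom M M.start (a ∷ w) + gapFrom N N.start (a ∷ w) ∎
    where
    open ≡-Reasoning
    startStep : Fin (m ℕ.+ n) → ℤ
    startStep c = ⟦ δ⊕ zero a (suc c) ⟧ * gapFrom _⊕_ (suc c) w

  gap-⊕ : ∀ x → gap _⊕_ x ≡ gap M x + gap N x
  gap-⊕ x = begin
    gap _⊕_ x                 ≡⟨ gap≡gapFrom _⊕_ x ⟩
    gapFrom _⊕_ zero (tape x) ≡⟨ gapFrom-⊕-start ▹ (map Sym.sym x ++ [ ◃ ]) ⟩
    gapFrom M M.start (tape x) + gapFrom N N.start (tape x)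
      ≡⟨ sym (cong₂ _+_ (gap≡gapFrom M x) (gap≡gapFrom N x)) ⟩
    gap M x + gap N x ∎
    where open ≡-Reasoning

PolySize-⊗ : ∀ {k} (M N : ℕ.ℕ → NFA k) → PolySize M → PolySize N → PolySize (λ n → M n ⊗ N n)
PolySize-⊗ M N = polyBounded-*

PolySize-⊕ : ∀ {k} (M N : ℕ.ℕ → NFA k) → PolySize M → PolySize N → PolySize (λ n → M n ⊕ N n)
PolySize-⊕ M N M-poly N-poly = polyBounded-suc (polyBounded-+ M-poly N-poly)

record GapRecognizer {k} (L : PromiseFamily k) : Set where
  field
    machine  : ℕ.ℕ → NFA k
    polySize : PolySize machine
    gap-pos  : ∀ {n x} → Pos L n x → gap (machine n) x ≡ 0ℤ
    gap-neg  : ∀ {n x} → Neg L n x → ¬ gap (machine n) x ≡ 0ℤ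

1C=⇒GapRecognizer : ∀ {k} {L : PromiseFamily k} → 1C= L → GapRecognizer L
1C=⇒GapRecognizer (F , (M , M-poly , F≡gap) , F-dom , F-pos , F-neg) = record
  { machine  = M
  ; polySize = M-poly
  ; gap-pos  = λ x∈L⁺ → trans (sym (F≡gap _ _ (F-dom _ _ (inj₁ x∈L⁺)))) (F-pos _ _ x∈L⁺)
  ; gap-neg  = λ x∈L⁻ → F-neg _ _ x∈L⁻ ∘ trans (F≡gap _ _ (F-dom _ _ (inj₂ x∈L⁻)))
  }

GapRecognizer⇒1C= : ∀ {k} {L : PromiseFamily k} → GapRecognizer L → 1C= L
GapRecognizer⇒1C= R =
  record { f = λ n → gap (machine n) ; D = λ _ _ → ⊤ } ,
  (machine , polySize , λ _ _ _ → refl) , (λ _ _ _ → tt) , (λ _ _ → gap-pos) , (λ _ _ → gap-neg)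
  where open GapRecognizer R

sumOfSquares : ∀ {k} → (ℕ.ℕ → NFA k) → (ℕ.ℕ → NFA k) → ℕ.ℕ → NFA k
sumOfSquares M N n = (M n ⊗ M n) ⊕ (N n ⊗ N n)

PolySize-sumOfSquares : ∀ {k} (M N : ℕ.ℕ → NFA k) →
                        PolySize M → PolySize N → PolySize (sumOfSquares M N)
PolySize-sumOfSquares M N M-poly N-poly =
  PolySize-⊕ (λ n → M n ⊗ M n) (λ n → N n ⊗ N n)
    (PolySize-⊗ M M M-poly M-poly) (PolySize-⊗ N N N-poly N-poly)

gap-sumOfSquares : ∀ {k} (M N : ℕ.ℕ → NFA k) n x →
                   gap (sumOfSquares M N n) x ≡ gap (M n) x * gap (M n) x + gap (N n) x * gap (N n) x
gap-sumOfSquares M N n x =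
  trans (gap-⊕ (M n ⊗ M n) (N n ⊗ N n) x) (cong₂ _+_ (gap-⊗ (M n) (M n) x) (gap-⊗ (N n) (N n) x))

GapRecognizer-∩ : ∀ {k} {L K : PromiseFamily k} →
                  GapRecognizer L → GapRecognizer K → GapRecognizer (L ∩ᶠ K)
GapRecognizer-∩ {k} {L} {K} R S = record
  { machine  = T
  ; polySize = PolySize-sumOfSquares R.machine S.machine R.polySize S.polySize
  ; gap-pos  = both≡0
  ; gap-neg  = one≢0
  }
  where
  module R = GapRecognizer R
  module S = GapRecognizer S
  T : ℕ.ℕ → NFA k
  T = sumOfSquares R.machine S.machine
  both≡0 : ∀ {n x} → Pos L n x × Pos K n x → gap (T n) x ≡ 0ℤ
  both≡0 {n} {x} (x∈L⁺ , x∈K⁺) = trans (gap-sumOfSquares R.machine S.machine n x)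
                                       (cong₂ (λ i j → i * i + j * j) (R.gap-pos x∈L⁺) (S.gap-pos x∈K⁺))
  one≢0 : ∀ {n x} → Neg L n x ⊎ Neg K n x → ¬ gap (T n) x ≡ 0ℤ
  one≢0 {n} {x} x∈L⁻⊎K⁻ eq
    with R≡0 , S≡0 ← i*i+j*j≡0⇒i≡0×j≡0 _ _ (trans (sym (gap-sumOfSquares R.machine S.machine n x)) eq)
    = [ (λ x∈L⁻ → R.gap-neg x∈L⁻ R≡0) , (λ x∈K⁻ → S.gap-neg x∈K⁻ S≡0) ]′ x∈L⁻⊎K⁻

1C=-∩ : ∀ {k} → ClosedUnderIntersection (1C= {k})
1C=-∩ L K L∈1C= K∈1C= =
  GapRecognizer⇒1C= (GapRecognizer-∩ (1C=⇒GapRecognizer {L = L} L∈1C=)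
                                     (1C=⇒GapRecognizer {L = K} K∈1C=))

lemma4p2 : (k : ℕ.ℕ) → ClosedUnderIntersection (1C= {k}) × ClosedUnderUnion (coClass (1C= {k}))
lemma4p2 k = 1C=-∩ , co-∪
  where
  -- co (co L ∪ᶠ co K) is definitionally co L ∪ᶠ co K, and 1C= only looks at its positive and
  -- negative instances, which are those of L ∩ᶠ K.
  co-∪ : ClosedUnderUnion (coClass (1C= {k}))
  co-∪ _ _ (L , L∈1C= , refl) (K , K∈1C= , refl) =
    co (co L ∪ᶠ co K) , 1C=-∩ L K L∈1C= K∈1C= , refl
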